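{- Let $a, b, c$ be nonzero integers with $\gcd(a,b,c)=1$, and let $X, Y \in M_2(\mathbb{Z})$. Then: 1) $aX^2 + bY^2 = cI$ and $XY \neq YX$ if and only if $$X = \begin{pmatrix} t_1 & t_2 \\ t_3 & -t_1 \end{pmatrix}, \quad Y = \begin{pmatrix} s_1 & s_2 \\ s_3 & -s_1 \end{pmatrix},$$ where $t_1, t_2, t_3, s_1, s_2, s_3 \in \mathbb{Z}$ satisfy $a(t_1^2 + t_2 t_3) + b(s_1^2 + s_2 s_3) = c$ and the vectors $(t_1, t_2, t_3)$ and $(s_1, s_2, s_3)$ are linearly independent over $\mathbb{Q}$; 2) $X^4 + Y^4 = c^4 I$ and $XY \neq YX$ if and only if $$X = \begin{pmatrix} t_1 & t_2 \\ t_3 & -t_1 \end{pmatrix}, \quad Y = \begin{pmatrix} s_1 & s_2 \\ s_3 & -s_1 \end{pmatrix},$$ where $t_1, t_2, t_3, s_1, s_2, s_3 \in \mathbb{Z}$ satisfy $(t_1^2 + t_2 t_3)^2 + (s_1^2 + s_2 s_3)^2 = c^4$ and the vectors $(t_1, t_2, t_3)$ and $(s_1, s_2, s_3)$ are linearly independent over $\mathbb{Q}$.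
   Context: $M_2(\mathbb{Z})$ denotes the ring of $2\times 2$ matrices with integer entries; $I$ is the $2\times 2$ identity matrix. -}

module Defs where

open import Data.Integer using (ℤ; +_; _+_; _*_; -_)
import Data.Integer.GCD as ℤG
import Data.Rational as ℚ
open import Data.Rational using (ℚ; 0ℚ)
open import Data.Product using (_×_)
open import Relation.Binary.PropositionalEquality using (_≡_)

record M₂ℤ : Set where
  constructor mat
  field
    e11 e12 e21 e22 : ℤ
open M₂ℤ public

infixl 7 _·_
infixl 6 _⊕_

_·_ : M₂ℤ → M₂ℤ → M₂ℤ
mat a b c d · mat p q r s =
  mat (a * p + b * r) (a * q + b * s) (c * p + d * r) (c * q + d * s)

_⊕_ : M₂ℤ → M₂ℤ → M₂ℤ
mat a b c d ⊕ mat p q r s = mat (a + p) (b + q) (c + r) (d + s)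

_⊙_ : ℤ → M₂ℤ → M₂ℤ
k ⊙ mat a b c d = mat (k * a) (k * b) (k * c) (k * d)

I : M₂ℤ
I = mat (+ 1) (+ 0) (+ 0) (+ 1)

sq : M₂ℤ → M₂ℤ
sq X = X · X

gcd₃ : ℤ → ℤ → ℤ → ℤ
gcd₃ a b c = ℤG.gcd (ℤG.gcd a b) c

tr0 : ℤ → ℤ → ℤ → M₂ℤ
tr0 t1 t2 t3 = mat t1 t2 t3 (- t1)

toℚ : ℤ → ℚ
toℚ z = z ℚ./ 1

LinIndepℚ : ℤ → ℤ → ℤ → ℤ → ℤ → ℤ → Set
LinIndepℚ t1 t2 t3 s1 s2 s3 =
  (λ' μ : ℚ) →
  (λ' ℚ.* toℚ t1) ℚ.+ (μ ℚ.* toℚ s1) ≡ 0ℚ →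
  (λ' ℚ.* toℚ t2) ℚ.+ (μ ℚ.* toℚ s2) ≡ 0ℚ →
  (λ' ℚ.* toℚ t3) ℚ.+ (μ ℚ.* toℚ s3) ≡ 0ℚ →
  (λ' ≡ 0ℚ) × (μ ≡ 0ℚ)

-- By Cayley–Hamilton X² = (tr X) X − (det X) I, so in both equations some combination l X + m Y
-- is a scalar matrix: l = a tr X, m = b tr Y in (1) and l = tr(X²) tr X, m = tr(Y²) tr Y in (2).
-- Modulo scalars a matrix is its vector (b, c, a − d), and X, Y commute exactly when these vectors
-- are parallel; so for non-commuting X, Y we get l = m = 0.  In (1) this makes X and Y traceless,
-- i.e. of the form (t₁ t₂ ; t₃ −t₁), whose square is (t₁² + t₂t₃) I.  In (2), tr X ≠ 0 would force
-- tr X² = 0, hence X⁴ = −(det X)² I and (tr X)² = 2 det X.  The equation then reads either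
-- −(det X)² − (det Y)² = c⁴, impossible by sign, or (2 det Y)² = (tr X)⁴ + 4c⁴, impossible because
-- x⁴ + 4y⁴ = z² has no solution with x y ≠ 0 (Fermat's infinite descent).
{-# OPTIONS --safe #-}
module Submission where

module QuarticDescent where
  open import Data.Nat.Base using (ℕ; zero; suc; _+_; _*_; _∸_; _<_; _≤_; s≤s⁻¹; ≢-nonZero)
  open import Data.Nat.Properties
  open import Data.Nat.Divisibility
  open import Data.Nat.DivMod using (_/_; m/n*n≡m)
  open import Data.Nat.GCD using (gcd; gcd[m,n]∣m; gcd[m,n]∣n; gcd[m,n]≢0)
  open import Data.Nat.Coprimality as Coprime using (Coprime; coprime-divisor; coprime-/gcd)
  open import Data.Nat.Primality using (prime[2]; euclidsLemma; prime⇒irreducible)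
  open import Data.Nat.Induction using (<-rec)
  open import Data.Nat.Tactic.RingSolver using (solve)
  open import Data.List.Base using ([]; _∷_)
  open import Data.Product using (∃-syntax; _×_; _,_)
  open import Data.Sum using (_⊎_; inj₁; inj₂; [_,_]′)
  open import Function.Base using (id; _∘_)
  open import Relation.Nullary using (¬_; yes; no; contradiction)
  open import Relation.Binary.Definitions using (tri<; tri≈; tri>)
  open import Relation.Binary.PropositionalEquality

  even-or-odd : ∀ n → (∃[ k ] n ≡ 2 * k) ⊎ (∃[ k ] n ≡ 1 + 2 * k)
  even-or-odd zero = inj₁ (0 , refl)
  even-or-odd (suc n) with even-or-odd n
  ... | inj₁ (k , refl) = inj₂ (k , refl)
  ... | inj₂ (k , refl) = inj₁ (suc k , cong suc (sym (+-suc k (k + 0))))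

  2∣n*n⇒2∣n : ∀ n → 2 ∣ n * n → 2 ∣ n
  2∣n*n⇒2∣n n 2∣n² = [ id , id ]′ (euclidsLemma n n prime[2] 2∣n²)

  ¬2∣⇒coprime : ∀ {n} → ¬ 2 ∣ n → Coprime 2 n
  ¬2∣⇒coprime 2∤n (d∣2 , d∣n) with prime⇒irreducible prime[2] d∣2
  ... | inj₁ d≡1 = d≡1
  ... | inj₂ refl = contradiction d∣n 2∤n

  coprime-∣ˡ : ∀ {d m n} → d ∣ m → Coprime m n → Coprime d n
  coprime-∣ˡ d∣m coprime (e∣d , e∣n) = coprime (∣-trans e∣d d∣m , e∣n)

  coprime-*ʳ : ∀ {m n o} → Coprime m n → Coprime m o → Coprime m (n * o)
  coprime-*ʳ m⊥n m⊥o (d∣m , d∣no) = m⊥o (d∣m , coprime-divisor (coprime-∣ˡ d∣m m⊥n) d∣no)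

  m*m≡0⇒m≡0 : ∀ m → m * m ≡ 0 → m ≡ 0
  m*m≡0⇒m≡0 m m²≡0 = [ id , id ]′ (m*n≡0⇒m≡0∨n≡0 m m²≡0)

  square-injective : ∀ m n → m * m ≡ n * n → m ≡ n
  square-injective m n eq with <-cmp m n
  ... | tri< m<n _ _ = contradiction eq (<⇒≢ (*-mono-< m<n m<n))
  ... | tri≈ _ m≡n _ = m≡n
  ... | tri> _ _ n<m = contradiction (sym eq) (<⇒≢ (*-mono-< n<m n<m))

  gcd-factorisation : ∀ m n → m ≢ 0 →
    ∃[ g ] g ≢ 0 × ∃[ m′ ] ∃[ n′ ] m ≡ m′ * g × n ≡ n′ * g × Coprime m′ n′
  gcd-factorisation m n m≢0 =
    g , g≢0 , m / g , n / g ,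
    sym (m/n*n≡m (gcd[m,n]∣m m n)) , sym (m/n*n≡m (gcd[m,n]∣n m n)) , coprime-/gcd m n
    where
    g : ℕ
    g = gcd m n
    g≢0 : g ≢ 0
    g≢0 = gcd[m,n]≢0 m n (inj₁ m≢0)
    instance _ = ≢-nonZero g≢0

  coprime-product-square : ∀ {m n k} → Coprime m n → m * n ≡ k * k → ∃[ a ] m ≡ a * a
  coprime-product-square {zero} _ _ = 0 , refl
  coprime-product-square {m@(suc _)} {n} {k} m⊥n mn≡k²
    with gcd-factorisation m k (λ ())
  ... | g , g≢0 , m′ , k′ , m≡m′g , refl , m′⊥k′ = g , trans m≡m′g (cong (_* g) m′≡g)
    where
    instance _ = ≢-nonZero g≢0
    m′n≡k′²g : m′ * n ≡ k′ * k′ * g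
    m′n≡k′²g = *-cancelʳ-≡ _ _ g (begin
      m′ * n * g        ≡⟨ solve (m′ ∷ n ∷ g ∷ []) ⟩
      m′ * g * n        ≡⟨ cong (_* n) (sym m≡m′g) ⟩
      m * n             ≡⟨ mn≡k² ⟩
      k′ * g * (k′ * g) ≡⟨ solve (k′ ∷ g ∷ []) ⟩
      k′ * k′ * g * g   ∎)
      where open ≡-Reasoning
    m′≡g : m′ ≡ g
    m′≡g = ∣-antisym
      (coprime-divisor (coprime-*ʳ m′⊥k′ m′⊥k′) (subst (m′ ∣_) m′n≡k′²g (m∣m*n n)))
      (coprime-divisor (coprime-∣ˡ (subst (g ∣_) (sym m≡m′g) (n∣m*n m′)) m⊥n)
        (subst (g ∣_) (trans (sym m′n≡k′²g) (*-comm m′ n)) (n∣m*n (k′ * k′))))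

  m*m∣n*n⇒m∣n : ∀ {m n} → m * m ∣ n * n → m ∣ n
  m*m∣n*n⇒m∣n {m} {n} m²∣n² with m ≟ 0
  ... | yes refl = subst (0 ∣_) (sym (m*m≡0⇒m≡0 n (0∣⇒≡0 m²∣n²))) ∣-refl
  ... | no m≢0 with gcd-factorisation m n m≢0
  ... | g , g≢0 , m′ , n′ , refl , refl , m′⊥n′ =
    subst (_∣ n′ * g) (cong (_* g) (sym m′≡1)) (*-monoˡ-∣ g (1∣ n′))
    where
    instance
      _ = ≢-nonZero g≢0
      _ = m*n≢0 g g
    rearrange : ∀ x → x * g * (x * g) ≡ x * x * (g * g)
    rearrange x = solve (x ∷ g ∷ [])
    m′∣n′ : m′ ∣ n′
    m′∣n′ = coprime-divisor m′⊥n′ (∣-trans (m∣m*n m′)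
      (*-cancelʳ-∣ (g * g) (subst₂ _∣_ (rearrange m′) (rearrange n′) m²∣n²)))
    m′≡1 : m′ ≡ 1
    m′≡1 = m′⊥n′ (∣-refl , m′∣n′)

  odd⇒1+2k : ∀ {n} → ¬ 2 ∣ n → ∃[ k ] n ≡ 1 + 2 * k
  odd⇒1+2k {n} 2∤n with even-or-odd n
  ... | inj₁ (k , refl) = contradiction (divides k (*-comm 2 k)) 2∤n
  ... | inj₂ n-odd = n-odd

  sum-of-odd-squares≢square : ∀ a b c →
    (1 + 2 * a) * (1 + 2 * a) + (1 + 2 * b) * (1 + 2 * b) ≢ c * c
  sum-of-odd-squares≢square a b c eq with even-or-odd c
  ... | inj₁ (k , refl) = even≢odd (k * k) (a + a * a + b + b * b) (*-cancelˡ-≡ _ _ 2 (begin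
    2 * (2 * (k * k))                          ≡⟨ solve (k ∷ []) ⟩
    2 * k * (2 * k)                            ≡⟨ sym eq ⟩
    (1 + 2 * a) * (1 + 2 * a) + (1 + 2 * b) * (1 + 2 * b) ≡⟨ solve (a ∷ b ∷ []) ⟩
    2 * suc (2 * (a + a * a + b + b * b))      ∎))
    where open ≡-Reasoning
  ... | inj₂ (k , refl) = even≢odd (suc (2 * (a + a * a + b + b * b))) (2 * (k + k * k)) (begin
    2 * suc (2 * (a + a * a + b + b * b))      ≡⟨ solve (a ∷ b ∷ []) ⟩
    (1 + 2 * a) * (1 + 2 * a) + (1 + 2 * b) * (1 + 2 * b) ≡⟨ eq ⟩
    (1 + 2 * k) * (1 + 2 * k)                  ≡⟨ solve (k ∷ []) ⟩
    suc (2 * (2 * (k + k * k)))                ∎)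
    where open ≡-Reasoning

  EuclidParameters : ℕ → ℕ → ℕ → Set
  EuclidParameters a b c =
    ∃[ m ] ∃[ n ] Coprime m n × a + n * n ≡ m * m × b ≡ 2 * (m * n) × c ≡ m * m + n * n

  private
    -- a² + (2B)² = (a + 2P)² says B² = P (a + P), a product of coprime factors.
    pythagorean-core : ∀ a B P → Coprime a B →
      a * a + 2 * B * (2 * B) ≡ (a + 2 * P) * (a + 2 * P) →
      EuclidParameters a (2 * B) (a + 2 * P)
    pythagorean-core a B P a⊥B pyth =
      conclude (coprime-product-square {k = B} P⊥a+P (sym B²≡P[a+P]))
               (coprime-product-square {k = B} (Coprime.sym P⊥a+P) (trans (*-comm (a + P) P) (sym B²≡P[a+P])))
      where
      B²≡P[a+P] : B * B ≡ P * (a + P)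
      B²≡P[a+P] = *-cancelˡ-≡ _ _ 4 (+-cancelˡ-≡ (a * a) _ _ (begin
        a * a + 4 * (B * B)           ≡⟨ solve (a ∷ B ∷ []) ⟩
        a * a + 2 * B * (2 * B)       ≡⟨ pyth ⟩
        (a + 2 * P) * (a + 2 * P)     ≡⟨ solve (a ∷ P ∷ []) ⟩
        a * a + 4 * (P * (a + P))     ∎))
        where open ≡-Reasoning
      P⊥a+P : Coprime P (a + P)
      P⊥a+P {d} (d∣P , d∣a+P) = coprime-*ʳ a⊥B a⊥B
        ( ∣m+n∣m⇒∣n (subst (d ∣_) (+-comm a P) d∣a+P) d∣P
        , subst (d ∣_) (sym B²≡P[a+P]) (∣m⇒∣m*n (a + P) d∣P))
      conclude : ∃[ n ] P ≡ n * n → ∃[ m ] a + P ≡ m * m →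
                 EuclidParameters a (2 * B) (a + 2 * P)
      conclude (n , P≡n²) (m , a+P≡m²) =
        m , n , m⊥n , subst (λ x → a + x ≡ m * m) P≡n² a+P≡m² , cong (2 *_) B≡mn , c≡m²+n²
        where
        open ≡-Reasoning
        m⊥n : Coprime m n
        m⊥n {d} (d∣m , d∣n) = P⊥a+P ( subst (d ∣_) (sym P≡n²) (∣m⇒∣m*n n d∣n)
                                , subst (d ∣_) (sym a+P≡m²) (∣m⇒∣m*n m d∣m))
        B≡mn : B ≡ m * n
        B≡mn = square-injective B (m * n) (begin
          B * B             ≡⟨ B²≡P[a+P] ⟩
          P * (a + P)       ≡⟨ cong₂ _*_ P≡n² a+P≡m² ⟩
          n * n * (m * m)   ≡⟨ solve (m ∷ n ∷ []) ⟩
          m * n * (m * n)   ∎)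
        c≡m²+n² : a + 2 * P ≡ m * m + n * n
        c≡m²+n² = begin
          a + 2 * P        ≡⟨ solve (a ∷ P ∷ []) ⟩
          (a + P) + P      ≡⟨ cong₂ _+_ a+P≡m² P≡n² ⟩
          m * m + n * n    ∎

  leg≤hypotenuse : ∀ {a b c} → a * a + b * b ≡ c * c → a ≤ c
  leg≤hypotenuse {a} {b} pyth = ≮⇒≥ λ c<a → <-irrefl (sym pyth)
    (<-≤-trans (*-mono-< c<a c<a) (m≤m+n (a * a) (b * b)))

  odd-gap : ∀ {a c} → ¬ 2 ∣ a → ¬ 2 ∣ c → a ≤ c → ∃[ P ] c ≡ a + 2 * P
  odd-gap 2∤a 2∤c a≤c with odd⇒1+2k 2∤a | odd⇒1+2k 2∤c
  ... | a′ , refl | c′ , refl =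
    c′ ∸ a′ , cong suc (trans (cong (2 *_) (sym (m+[n∸m]≡n {a′} {c′} a′≤c′))) (*-distribˡ-+ 2 a′ (c′ ∸ a′)))
    where
    a′≤c′ : a′ ≤ c′
    a′≤c′ = *-cancelˡ-≤ 2 (s≤s⁻¹ a≤c)

  odd-leg⇒odd-hypotenuse : ∀ {a b c} → ¬ 2 ∣ a → 2 ∣ b → a * a + b * b ≡ c * c → ¬ 2 ∣ c
  odd-leg⇒odd-hypotenuse {a} {b} {c} 2∤a 2∣b pyth 2∣c = 2∤a (2∣n*n⇒2∣n a
    (∣m+n∣m⇒∣n (subst (2 ∣_) (trans (sym pyth) (+-comm (a * a) (b * b))) (∣m⇒∣m*n c 2∣c))
               (∣m⇒∣m*n b 2∣b)))

  primitive-pythagorean : ∀ {a b c} → ¬ 2 ∣ a → Coprime a b → a * a + b * b ≡ c * c →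
    EuclidParameters a b c
  primitive-pythagorean {a} {b} {c} 2∤a a⊥b pyth with odd⇒1+2k 2∤a | even-or-odd b
  ... | a′ , refl | inj₂ (b′ , refl) = contradiction pyth (sum-of-odd-squares≢square a′ b′ c)
  ... | a′ , refl | inj₁ (B , refl)
    with odd-gap {c = c} 2∤a (odd-leg⇒odd-hypotenuse 2∤a (divides B (*-comm 2 B)) pyth) (leg≤hypotenuse {b = 2 * B} pyth)
  ... | P , refl = pythagorean-core a B P (Coprime.sym (coprime-∣ˡ (n∣m*n 2) (Coprime.sym a⊥b))) pyth

  coprime-square : ∀ {m n} → Coprime m n → Coprime (m * m) (n * n)
  coprime-square {m} {n} m⊥n = coprime-*ʳ m²⊥n m²⊥n
    where
    m²⊥n : Coprime (m * m) n
    m²⊥n = Coprime.sym (coprime-*ʳ (Coprime.sym m⊥n) (Coprime.sym m⊥n))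

  Solution : ℕ → Set
  Solution z = ∃[ x ] ∃[ y ] x ≢ 0 × y ≢ 0 × x * x * (x * x) + 4 * (y * y * (y * y)) ≡ z * z

  Descends : ℕ → Set
  Descends z = ∃[ z′ ] z′ < z × Solution z′

  solution⇒≢0 : ∀ {x y z} → x ≢ 0 → x * x * (x * x) + 4 * (y * y * (y * y)) ≡ z * z → z ≢ 0
  solution⇒≢0 {x} x≢0 eq refl = x≢0 (m*m≡0⇒m≡0 x (m*m≡0⇒m≡0 (x * x) (m+n≡0⇒m≡0 _ eq)))

  descent-even : ∀ {z x y} → x ≢ 0 → y ≢ 0 → 2 ∣ x →
    x * x * (x * x) + 4 * (y * y * (y * y)) ≡ z * z → Descends z
  descent-even {z} {y = y} x≢0 y≢0 (divides x′ refl) eq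
    with 2∣n*n⇒2∣n z (divides (8 * (x′ * x′ * (x′ * x′)) + 2 * (y * y * (y * y)))
                     (trans (sym eq) (solve (x′ ∷ y ∷ []))))
  ... | divides z′ refl = z′ , z′<2z′ , y , x′ , y≢0 , x′≢0 , eq′
    where
    x′≢0 : x′ ≢ 0
    x′≢0 refl = x≢0 refl
    eq′ : y * y * (y * y) + 4 * (x′ * x′ * (x′ * x′)) ≡ z′ * z′
    eq′ = *-cancelˡ-≡ _ _ 4 (begin
      4 * (y * y * (y * y) + 4 * (x′ * x′ * (x′ * x′)))              ≡⟨ solve (x′ ∷ y ∷ []) ⟩
      x′ * 2 * (x′ * 2) * (x′ * 2 * (x′ * 2)) + 4 * (y * y * (y * y)) ≡⟨ eq ⟩
      z′ * 2 * (z′ * 2)                                               ≡⟨ solve (z′ ∷ []) ⟩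
      4 * (z′ * z′)                                                   ∎)
      where open ≡-Reasoning
    z′<2z′ : z′ < z′ * 2
    z′<2z′ = m<m*n z′ 2 {{≢-nonZero (solution⇒≢0 {y = x′} y≢0 eq′)}} ≤-refl

  descent-common-factor : ∀ {z x y} → x ≢ 0 → y ≢ 0 → ¬ Coprime x y →
    x * x * (x * x) + 4 * (y * y * (y * y)) ≡ z * z → Descends z
  descent-common-factor {z} {x} {y} x≢0 y≢0 x⊥̸y eq with gcd-factorisation x y x≢0
  ... | g , g≢0 , x′ , y′ , refl , refl , x′⊥y′
    with m*m∣n*n⇒m∣n {g * g} {z} (divides (x′ * x′ * (x′ * x′) + 4 * (y′ * y′ * (y′ * y′)))
           (trans (sym eq) (solve (x′ ∷ y′ ∷ g ∷ []))))
  ... | divides z′ refl = z′ , z′<z′g² , x′ , y′ , x′≢0 , y′≢0 , eq′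
    where
    instance
      _ = ≢-nonZero g≢0
      _ = m*n≢0 g g
      _ = m*n≢0 (g * g) (g * g)
    x′≢0 : x′ ≢ 0
    x′≢0 refl = x≢0 refl
    y′≢0 : y′ ≢ 0
    y′≢0 refl = y≢0 refl
    eq′ : x′ * x′ * (x′ * x′) + 4 * (y′ * y′ * (y′ * y′)) ≡ z′ * z′
    eq′ = *-cancelʳ-≡ _ _ (g * g * (g * g)) (begin
      (x′ * x′ * (x′ * x′) + 4 * (y′ * y′ * (y′ * y′))) * (g * g * (g * g))
        ≡⟨ solve (x′ ∷ y′ ∷ g ∷ []) ⟩
      x′ * g * (x′ * g) * (x′ * g * (x′ * g)) + 4 * (y′ * g * (y′ * g) * (y′ * g * (y′ * g)))
        ≡⟨ eq ⟩
      z′ * (g * g) * (z′ * (g * g))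
        ≡⟨ solve (z′ ∷ g ∷ []) ⟩
      z′ * z′ * (g * g * (g * g)) ∎)
      where open ≡-Reasoning
    g≢1 : g ≢ 1
    g≢1 refl = x⊥̸y (subst₂ Coprime (sym (*-identityʳ x′)) (sym (*-identityʳ y′)) x′⊥y′)
    1<g² : 1 < g * g
    1<g² = <-≤-trans (≤∧≢⇒< (n≢0⇒n>0 g≢0) (g≢1 ∘ sym)) (m≤m*n g g)
    z′<z′g² : z′ < z′ * (g * g)
    z′<z′g² = m<m*n z′ (g * g) {{≢-nonZero (solution⇒≢0 {y = y′} x′≢0 eq′)}} 1<g²

  coprime-product-squares : ∀ {m n k} → Coprime m n → m * n ≡ k * k → ∃[ a ] ∃[ b ] m ≡ a * a × n ≡ b * b
  coprime-product-squares {m} {n} {k} m⊥n mn≡k² with coprime-product-square {k = k} m⊥n mn≡k²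
    | coprime-product-square {k = k} (Coprime.sym m⊥n) (trans (*-comm n m) mn≡k²)
  ... | a , m≡a² | b , n≡b² = a , b , m≡a² , n≡b²

  half-square-split : ∀ {r s k} → Coprime r s → 2 * (k * k) ≡ r * s → 2 ∣ r →
    ∃[ u ] ∃[ v ] r ≡ 2 * (u * u) × s ≡ v * v
  half-square-split {r} {s} {k} r⊥s 2k²≡rs (divides r′ refl)
    with coprime-product-squares {r′} {s} {k} (coprime-∣ˡ (m∣m*n 2) r⊥s)
           (sym (*-cancelˡ-≡ _ _ 2 (trans 2k²≡rs (solve (r′ ∷ s ∷ [])))))
  ... | u , v , refl , s≡v² = u , v , *-comm (u * u) 2 , s≡v²

  even-factor-split : ∀ {r s k} → k ≢ 0 → Coprime r s → 2 * (k * k) ≡ r * s →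
    ∃[ u ] ∃[ v ] u ≢ 0 × v ≢ 0 × v * v * (v * v) + 4 * (u * u * (u * u)) ≡ r * r + s * s
  even-factor-split {r} {s} {k} k≢0 r⊥s 2k²≡rs
    with euclidsLemma r s prime[2] (divides (k * k) (trans (sym 2k²≡rs) (*-comm 2 (k * k))))
  ... | inj₁ 2∣r with half-square-split {k = k} r⊥s 2k²≡rs 2∣r
  ...   | u , v , refl , refl = u , v , u≢0 , v≢0 , solve (u ∷ v ∷ [])
    where
    u≢0 : u ≢ 0
    u≢0 refl = k≢0 (m*m≡0⇒m≡0 k (*-cancelˡ-≡ _ _ 2 2k²≡rs))
    v≢0 : v ≢ 0
    v≢0 refl = k≢0 (m*m≡0⇒m≡0 k (*-cancelˡ-≡ _ _ 2 (trans 2k²≡rs (*-zeroʳ (2 * (u * u))))))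
  even-factor-split {r} {s} {k} k≢0 r⊥s 2k²≡rs | inj₂ 2∣s
    with half-square-split {k = k} (Coprime.sym r⊥s) (trans 2k²≡rs (*-comm r s)) 2∣s
  ...   | u , v , refl , refl = u , v , u≢0 , v≢0 , solve (u ∷ v ∷ [])
    where
    u≢0 : u ≢ 0
    u≢0 refl = k≢0 (m*m≡0⇒m≡0 k (*-cancelˡ-≡ _ _ 2 (trans 2k²≡rs (*-zeroʳ (v * v)))))
    v≢0 : v ≢ 0
    v≢0 refl = k≢0 (m*m≡0⇒m≡0 k (*-cancelˡ-≡ _ _ 2 2k²≡rs))

  -- Euclid's parametrisation of x² + (q²)² = (p²)² gives q² = 2rs and p² = r² + s² with r ⊥ s,
  -- so one of r, s is twice a square and the other is a square.
  odd-quartic-step : ∀ {x p q} → q ≢ 0 → ¬ 2 ∣ x → Coprime x (q * q) →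
    x * x + q * q * (q * q) ≡ p * p * (p * p) → Solution p
  odd-quartic-step {x} {p} {q} q≢0 2∤x x⊥q² eq with primitive-pythagorean {c = p * p} 2∤x x⊥q² eq
  ... | r , s , r⊥s , _ , q²≡2rs , p²≡r²+s²
    with 2∣n*n⇒2∣n q (divides (r * s) (trans q²≡2rs (*-comm 2 (r * s))))
  ... | divides q′ refl
    with even-factor-split {k = q′} (λ { refl → q≢0 refl }) r⊥s
           (*-cancelˡ-≡ (2 * (q′ * q′)) (r * s) 2 (sym (trans (sym q²≡2rs) (solve (q′ ∷ [])))))
  ... | u , v , u≢0 , v≢0 , v⁴+4u⁴≡r²+s² = v , u , v≢0 , u≢0 , trans v⁴+4u⁴≡r²+s² (sym p²≡r²+s²)

  -- (x², 2y², z) is a primitive Pythagorean triple, so z = m² + n² with m n = y², whence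
  -- m = p², n = q² and x² + (q²)² = (p²)², with p < z.
  descent-primitive : ∀ {z x y} → y ≢ 0 → ¬ 2 ∣ x → Coprime x y →
    x * x * (x * x) + 4 * (y * y * (y * y)) ≡ z * z → Descends z
  descent-primitive {z} {x} {y} y≢0 2∤x x⊥y eq =
    conclude (primitive-pythagorean 2∤x² x²⊥2y² (sym (trans (sym eq) (solve (x ∷ y ∷ [])))))
    where
    2∤x² : ¬ 2 ∣ x * x
    2∤x² = 2∤x ∘ 2∣n*n⇒2∣n x
    x²⊥2y² : Coprime (x * x) (2 * (y * y))
    x²⊥2y² = coprime-*ʳ (Coprime.sym (¬2∣⇒coprime 2∤x²)) (coprime-square x⊥y)
    conclude : EuclidParameters (x * x) (2 * (y * y)) z → Descends z
    conclude (m , n , m⊥n , x²+n²≡m² , 2y²≡2mn , z≡m²+n²)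
      with coprime-product-squares {k = y} m⊥n (sym (*-cancelˡ-≡ _ _ 2 2y²≡2mn))
    ... | p , q , refl , refl = p , p<z , odd-quartic-step {p = p} q≢0 2∤x x⊥q² x²+n²≡m²
      where
      pq≢0 : p * p * (q * q) ≢ 0
      pq≢0 pq≡0 = y≢0 (m*m≡0⇒m≡0 y (trans (*-cancelˡ-≡ _ _ 2 2y²≡2mn) pq≡0))
      p≢0 : p ≢ 0
      p≢0 refl = pq≢0 refl
      q≢0 : q ≢ 0
      q≢0 refl = pq≢0 (*-zeroʳ (p * p))
      x⊥q² : Coprime x (q * q)
      x⊥q² {d} (d∣x , d∣q²) = Coprime.sym (coprime-*ʳ (Coprime.sym m⊥n) (Coprime.sym m⊥n))
        (subst (d ∣_) x²+n²≡m² (∣m∣n⇒∣m+n (∣m⇒∣m*n x d∣x) (∣m⇒∣m*n (q * q) d∣q²)) , d∣q²)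
      p<z : p < z
      p<z = begin-strict
        p                                 ≤⟨ m≤m*n p p {{≢-nonZero p≢0}} ⟩
        p * p                             ≤⟨ m≤m*n (p * p) (p * p) {{≢-nonZero λ p²≡0 → p≢0 (m*m≡0⇒m≡0 p p²≡0)}} ⟩
        p * p * (p * p)                   <⟨ m<m+n _ (n≢0⇒n>0 λ q⁴≡0 → q≢0 (m*m≡0⇒m≡0 q (m*m≡0⇒m≡0 (q * q) q⁴≡0))) ⟩
        p * p * (p * p) + q * q * (q * q) ≡⟨ sym z≡m²+n² ⟩
        z                                 ∎
        where open ≤-Reasoning

  descent : ∀ {z} → Solution z → Descends z
  descent (x , y , x≢0 , y≢0 , eq) with 2 ∣? x
  ... | yes 2∣x = descent-even x≢0 y≢0 2∣x eq
  ... | no 2∤x with Coprime.coprime? x y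
  ...   | no x⊥̸y = descent-common-factor x≢0 y≢0 x⊥̸y eq
  ...   | yes x⊥y = descent-primitive y≢0 2∤x x⊥y eq

  no-quartic-solution : ∀ z → ¬ Solution z
  no-quartic-solution = <-rec (λ z → ¬ Solution z) λ z rec sol →
    let z′ , z′<z , sol′ = descent sol in rec z′<z sol′

open QuarticDescent using (no-quartic-solution)

-- Linear dependence and 2 × 2 minors

open import Algebra.Bundles using (CommutativeRing)
import Algebra.Definitions
open import Data.Sum using (_⊎_; inj₁; inj₂; [_,_]′)
open import Relation.Nullary using (¬_; yes; no; contradiction)

module _ {c ℓ} (R : CommutativeRing c ℓ) where
  open CommutativeRing R
  open Algebra.Definitions _≈_ using (AlmostLeftCancellative)
  open import Algebra.Properties.Ring ring using (-‿distribˡ-*)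
  open import Algebra.Properties.Group +-group using (inverseˡ-unique)
  open import Relation.Binary.Reasoning.Setoid setoid

  private
    scaled-minor : ∀ {l m ui vi uj vj} → l * ui + m * vi ≈ 0# → l * uj + m * vj ≈ 0# →
      l * (ui * vj) ≈ l * (uj * vi)
    scaled-minor {l} {m} {ui} {vi} {uj} {vj} hi hj = begin
      l * (ui * vj)   ≈⟨ *-assoc l ui vj ⟨
      l * ui * vj     ≈⟨ *-congʳ (inverseˡ-unique _ _ hi) ⟩
      - (m * vi) * vj ≈⟨ -‿distribˡ-* (m * vi) vj ⟨
      - (m * vi * vj) ≈⟨ -‿cong m*vi*vj≈m*vj*vi ⟩
      - (m * vj * vi) ≈⟨ -‿distribˡ-* (m * vj) vi ⟩
      - (m * vj) * vi ≈⟨ *-congʳ (inverseˡ-unique _ _ hj) ⟨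
      l * uj * vi     ≈⟨ *-assoc l uj vi ⟩
      l * (uj * vi)   ∎
      where
      m*vi*vj≈m*vj*vi : m * vi * vj ≈ m * vj * vi
      m*vi*vj≈m*vj*vi = begin
        m * vi * vj   ≈⟨ *-assoc m vi vj ⟩
        m * (vi * vj) ≈⟨ *-congˡ (*-comm vi vj) ⟩
        m * (vj * vi) ≈⟨ *-assoc m vj vi ⟨
        m * vj * vi   ∎

  dependent⇒minor≈ : AlmostLeftCancellative 0# _*_ → ∀ {l m ui vi uj vj} → ¬ l ≈ 0# ⊎ ¬ m ≈ 0# →
    l * ui + m * vi ≈ 0# → l * uj + m * vj ≈ 0# → ui * vj ≈ uj * vi
  dependent⇒minor≈ cancel {l} (inj₁ l≉0) hi hj = cancel l _ _ l≉0 (scaled-minor hi hj)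
  dependent⇒minor≈ cancel {l} {m} {ui} {vi} {uj} {vj} (inj₂ m≉0) hi hj = begin
    ui * vj ≈⟨ *-comm ui vj ⟩
    vj * ui ≈⟨ cancel m _ _ m≉0 (scaled-minor (trans (+-comm (m * vi) (l * ui)) hi)
                                               (trans (+-comm (m * vj) (l * uj)) hj)) ⟨
    vi * uj ≈⟨ *-comm vi uj ⟩
    uj * vi ∎

open import Defs
open import Data.Empty using (⊥; ⊥-elim)
open import Data.Integer.Base as ℤ
  using (ℤ; +_; -[1+_]; 0ℤ; 1ℤ; -1ℤ; _+_; _*_; -_; _-_; _^_; ∣_∣; ≢-nonZero)
import Data.Integer.Properties as ℤ
open import Data.Integer.Tactic.RingSolver using (solve-∀; solve)
open import Data.List.Base using ([]; _∷_)
import Data.Nat.Base as ℕ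
import Data.Nat.Properties as ℕ
open import Data.Nat.Coprimality using (Coprime; 1-coprimeTo)
import Data.Nat.Coprimality as Coprime
open import Data.Product using (Σ; _×_; _,_; proj₁; proj₂; ∃-syntax; map; uncurry)
open import Data.Rational.Base as ℚ using (ℚ; 0ℚ; 1ℚ; mkℚ; ↥_)
import Data.Rational.Properties as ℚ
open import Function.Base using (_∘_; _∋_)
open import Function.Bundles using (_⇔_; mk⇔; module Equivalence)
open import Function.Construct.Composition using (_⇔-∘_)
open import Relation.Nullary.Decidable using (decidable-stable)
open import Relation.Binary.PropositionalEquality

nonzero-factor : ∀ {a x} → a ≢ 0ℤ → a * x ≡ 0ℤ → x ≡ 0ℤ
nonzero-factor {a} a≢0 ax≡0 with ℤ.i*j≡0⇒i≡0∨j≡0 a ax≡0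
... | inj₁ a≡0 = contradiction a≡0 a≢0
... | inj₂ x≡0 = x≡0

ℤ-*-almostCancelˡ : Algebra.Definitions.AlmostLeftCancellative _≡_ 0ℤ _*_
ℤ-*-almostCancelˡ l x y l≢0 = ℤ.*-cancelˡ-≡ l x y {{≢-nonZero l≢0}}

≡⇔≡-scaled : ∀ k {x y u v} → k ≢ 0ℤ → x - y ≡ k * (u - v) → (x ≡ y ⇔ u ≡ v)
≡⇔≡-scaled k {x} {y} {u} {v} k≢0 x-y≡k[u-v] = mk⇔
  (λ x≡y → ℤ.i-j≡0⇒i≡j u v (nonzero-factor k≢0 (trans (sym x-y≡k[u-v]) (ℤ.i≡j⇒i-j≡0 x≡y))))
  (λ u≡v → ℤ.i-j≡0⇒i≡j x y (trans x-y≡k[u-v] (trans (cong (k *_) (ℤ.i≡j⇒i-j≡0 u≡v)) (ℤ.*-zeroʳ k))))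

ℤ³ : Set
ℤ³ = ℤ × ℤ × ℤ

0³ : ℤ³
0³ = 0ℤ , 0ℤ , 0ℤ

infixl 7 _·³_
infixl 6 _+³_

_·³_ : ℤ → ℤ³ → ℤ³
k ·³ (u₁ , u₂ , u₃) = k * u₁ , k * u₂ , k * u₃

_+³_ : ℤ³ → ℤ³ → ℤ³
(u₁ , u₂ , u₃) +³ (v₁ , v₂ , v₃) = u₁ + v₁ , u₂ + v₂ , u₃ + v₃

·³-assoc : ∀ k l u → k ·³ (l ·³ u) ≡ (k * l) ·³ u
·³-assoc k l (u₁ , u₂ , u₃) =
  cong₂ _,_ (sym (ℤ.*-assoc k l u₁)) (cong₂ _,_ (sym (ℤ.*-assoc k l u₂)) (sym (ℤ.*-assoc k l u₃)))

Parallel : ℤ³ → ℤ³ → Set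
Parallel (u₁ , u₂ , u₃) (v₁ , v₂ , v₃) = u₁ * v₂ ≡ u₂ * v₁ × u₁ * v₃ ≡ u₃ * v₁ × u₂ * v₃ ≡ u₃ * v₂

annihilated⇒parallel : ∀ {l m} u v → l ≢ 0ℤ ⊎ m ≢ 0ℤ → l ·³ u +³ m ·³ v ≡ 0³ → Parallel u v
annihilated⇒parallel {l} {m} (u₁ , u₂ , u₃) (v₁ , v₂ , v₃) nonzero lu+mv≡0 =
  minor h₁ h₂ , minor h₁ h₃ , minor h₂ h₃
  where
  minor : ∀ {ui vi uj vj} → l * ui + m * vi ≡ 0ℤ → l * uj + m * vj ≡ 0ℤ → ui * vj ≡ uj * vi
  minor = dependent⇒minor≈ ℤ.+-*-commutativeRing ℤ-*-almostCancelˡ nonzero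
  h₁ : l * u₁ + m * v₁ ≡ 0ℤ
  h₁ = cong proj₁ lu+mv≡0
  h₂ : l * u₂ + m * v₂ ≡ 0ℤ
  h₂ = cong (proj₁ ∘ proj₂) lu+mv≡0
  h₃ : l * u₃ + m * v₃ ≡ 0ℤ
  h₃ = cong (proj₂ ∘ proj₂) lu+mv≡0

private
  cross-cancel : ∀ a b c d → a * b ≡ c * d → d * c + - a * b ≡ 0ℤ
  cross-cancel a b c d ab≡cd = begin
    d * c + - a * b ≡⟨ solve (a ∷ b ∷ c ∷ d ∷ []) ⟩
    c * d - a * b   ≡⟨ ℤ.i≡j⇒i-j≡0 (sym ab≡cd) ⟩
    0ℤ              ∎
    where open ≡-Reasoning

-- A nonzero coordinate vᵢ of v gives the relation vᵢ u − uᵢ v = 0.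
parallel⇒annihilated : ∀ u v → Parallel u v → ∃[ l ] ∃[ m ] (l ≢ 0ℤ ⊎ m ≢ 0ℤ) × l ·³ u +³ m ·³ v ≡ 0³
parallel⇒annihilated (u₁ , u₂ , u₃) (v₁ , v₂ , v₃) (p₁₂ , p₁₃ , p₂₃)
  with v₁ ℤ.≟ 0ℤ | v₂ ℤ.≟ 0ℤ | v₃ ℤ.≟ 0ℤ
... | no v₁≢0 | _ | _ = v₁ , - u₁ , inj₁ v₁≢0 ,
  cong₂ _,_ (cross-cancel u₁ v₁ u₁ v₁ refl)
    (cong₂ _,_ (cross-cancel u₁ v₂ u₂ v₁ p₁₂) (cross-cancel u₁ v₃ u₃ v₁ p₁₃))
... | yes _ | no v₂≢0 | _ = v₂ , - u₂ , inj₁ v₂≢0 ,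
  cong₂ _,_ (cross-cancel u₂ v₁ u₁ v₂ (sym p₁₂))
    (cong₂ _,_ (cross-cancel u₂ v₂ u₂ v₂ refl) (cross-cancel u₂ v₃ u₃ v₂ p₂₃))
... | yes _ | yes _ | no v₃≢0 = v₃ , - u₃ , inj₁ v₃≢0 ,
  cong₂ _,_ (cross-cancel u₃ v₁ u₁ v₃ (sym p₁₃))
    (cong₂ _,_ (cross-cancel u₃ v₂ u₂ v₃ (sym p₂₃)) (cross-cancel u₃ v₃ u₃ v₃ refl))
... | yes refl | yes refl | yes refl = 0ℤ , 1ℤ , inj₂ (λ ()) , refl

-- Commuting matrices

mat-cong : ∀ {a b c d a′ b′ c′ d′} → a ≡ a′ → b ≡ b′ → c ≡ c′ → d ≡ d′ → mat a b c d ≡ mat a′ b′ c′ d′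
mat-cong refl refl refl refl = refl

tr : M₂ℤ → ℤ
tr (mat a _ _ d) = a + d

det : M₂ℤ → ℤ
det (mat a b c d) = a * d - b * c

-- M is determined modulo scalar matrices by shape M, and the entries of the commutator [X, Y]
-- are, up to sign, the 2 × 2 minors of shape X and shape Y.
shape : M₂ℤ → ℤ³
shape (mat a b c d) = b , c , a - d

commute⇔parallel : ∀ X Y → X · Y ≡ Y · X ⇔ Parallel (shape X) (shape Y)
commute⇔parallel (mat a b c d) (mat p q r s) = mk⇔
  (λ XY≡YX → to e₁₁ (cong e11 XY≡YX) , to e₁₂ (cong e12 XY≡YX) , to e₂₁ (cong e21 XY≡YX))
  (λ (m₁ , m₂ , m₃) → mat-cong (from e₁₁ m₁) (from e₁₂ m₂) (from e₂₁ m₃) (from e₂₂ m₁))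
  where
  open Equivalence
  e₁₁ : (a * p + b * r ≡ p * a + q * c) ⇔ (b * r ≡ c * q)
  e₁₁ = ≡⇔≡-scaled 1ℤ (λ ()) ((a * p + b * r) - (p * a + q * c) ≡ 1ℤ * (b * r - c * q) ∋
    solve (a ∷ b ∷ c ∷ p ∷ q ∷ r ∷ []))
  e₁₂ : (a * q + b * s ≡ p * b + q * d) ⇔ (b * (p - s) ≡ (a - d) * q)
  e₁₂ = ≡⇔≡-scaled -1ℤ (λ ()) ((a * q + b * s) - (p * b + q * d) ≡ -1ℤ * (b * (p - s) - (a - d) * q) ∋
    solve (a ∷ b ∷ d ∷ p ∷ q ∷ s ∷ []))
  e₂₁ : (c * p + d * r ≡ r * a + s * c) ⇔ (c * (p - s) ≡ (a - d) * r)
  e₂₁ = ≡⇔≡-scaled 1ℤ (λ ()) ((c * p + d * r) - (r * a + s * c) ≡ 1ℤ * (c * (p - s) - (a - d) * r) ∋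
    solve (a ∷ c ∷ d ∷ p ∷ r ∷ s ∷ []))
  e₂₂ : (c * q + d * s ≡ r * b + s * d) ⇔ (b * r ≡ c * q)
  e₂₂ = ≡⇔≡-scaled -1ℤ (λ ()) ((c * q + d * s) - (r * b + s * d) ≡ -1ℤ * (b * r - c * q) ∋
    solve (b ∷ c ∷ d ∷ q ∷ r ∷ s ∷ []))

commute-tr0⇔parallel : ∀ t1 t2 t3 s1 s2 s3 →
  tr0 t1 t2 t3 · tr0 s1 s2 s3 ≡ tr0 s1 s2 s3 · tr0 t1 t2 t3 ⇔ Parallel (t1 , t2 , t3) (s1 , s2 , s3)
commute-tr0⇔parallel t1 t2 t3 s1 s2 s3 = shapes-parallel ⇔-∘ commute⇔parallel (tr0 t1 t2 t3) (tr0 s1 s2 s3)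
  where
  open Equivalence
  e₂ : (t2 * (s1 - - s1) ≡ (t1 - - t1) * s2) ⇔ (t1 * s2 ≡ t2 * s1)
  e₂ = ≡⇔≡-scaled (- + 2) (λ ()) (t2 * (s1 - - s1) - (t1 - - t1) * s2 ≡ - + 2 * (t1 * s2 - t2 * s1) ∋
    solve (t1 ∷ t2 ∷ s1 ∷ s2 ∷ []))
  e₃ : (t3 * (s1 - - s1) ≡ (t1 - - t1) * s3) ⇔ (t1 * s3 ≡ t3 * s1)
  e₃ = ≡⇔≡-scaled (- + 2) (λ ()) (t3 * (s1 - - s1) - (t1 - - t1) * s3 ≡ - + 2 * (t1 * s3 - t3 * s1) ∋
    solve (t1 ∷ t3 ∷ s1 ∷ s3 ∷ []))
  shapes-parallel : Parallel (shape (tr0 t1 t2 t3)) (shape (tr0 s1 s2 s3)) ⇔ Parallel (t1 , t2 , t3) (s1 , s2 , s3)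
  shapes-parallel = mk⇔ (λ (p₁ , p₂ , p₃) → to e₂ p₂ , to e₃ p₃ , p₁)
                        (λ (q₁ , q₂ , q₃) → q₃ , from e₂ q₁ , from e₃ q₂)

-- Linear independence over ℚ

private
  -- toℚ z is the normal form mkℚ z 0 _, on which ℚ's operations compute.
  toℚ-canonical : ∀ z → Σ (Coprime ∣ z ∣ 1) λ c → toℚ z ≡ mkℚ z 0 c
  toℚ-canonical (+ n) = Coprime.sym (1-coprimeTo n) , ℚ.normalize-coprime (Coprime.sym (1-coprimeTo n))
  toℚ-canonical -[1+ n ] =
    Coprime.sym (1-coprimeTo (ℕ.suc n)) , cong ℚ.-_ (ℚ.normalize-coprime (Coprime.sym (1-coprimeTo (ℕ.suc n))))

toℚ-injective : ∀ {a b} → toℚ a ≡ toℚ b → a ≡ b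
toℚ-injective {a} {b} eq with toℚ-canonical a | toℚ-canonical b
... | _ , a≡ | _ , b≡ = cong ↥_ (trans (sym a≡) (trans eq b≡))

toℚ-* : ∀ a b → toℚ (a * b) ≡ toℚ a ℚ.* toℚ b
toℚ-* a b with toℚ-canonical a | toℚ-canonical b
... | _ , a≡ | _ , b≡ rewrite a≡ | b≡ = refl

toℚ-+ : ∀ a b → toℚ (a + b) ≡ toℚ a ℚ.+ toℚ b
toℚ-+ a b with toℚ-canonical a | toℚ-canonical b
... | _ , a≡ | _ , b≡ rewrite a≡ | b≡ =
  cong₂ (λ x y → (x + y) ℚ./ 1) (sym (ℤ.*-identityʳ a)) (sym (ℤ.*-identityʳ b))

toℚ-combination : ∀ {l m x y} → l * x + m * y ≡ 0ℤ → toℚ l ℚ.* toℚ x ℚ.+ toℚ m ℚ.* toℚ y ≡ 0ℚ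
toℚ-combination {l} {m} {x} {y} eq = begin
  toℚ l ℚ.* toℚ x ℚ.+ toℚ m ℚ.* toℚ y ≡⟨ cong₂ ℚ._+_ (toℚ-* l x) (toℚ-* m y) ⟨
  toℚ (l * x) ℚ.+ toℚ (m * y)         ≡⟨ toℚ-+ (l * x) (m * y) ⟨
  toℚ (l * x + m * y)                 ≡⟨ cong toℚ eq ⟩
  0ℚ                                  ∎
  where open ≡-Reasoning

ℚ-*-almostCancelˡ : Algebra.Definitions.AlmostLeftCancellative _≡_ 0ℚ ℚ._*_
ℚ-*-almostCancelˡ l x y l≢0 lx≡ly = begin
  x                    ≡⟨ ℚ.*-identityˡ x ⟨
  1ℚ ℚ.* x             ≡⟨ cong (ℚ._* x) (ℚ.*-inverseˡ l) ⟨
  ℚ.1/ l ℚ.* l ℚ.* x   ≡⟨ ℚ.*-assoc (ℚ.1/ l) l x ⟩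
  ℚ.1/ l ℚ.* (l ℚ.* x) ≡⟨ cong (ℚ.1/ l ℚ.*_) lx≡ly ⟩
  ℚ.1/ l ℚ.* (l ℚ.* y) ≡⟨ ℚ.*-assoc (ℚ.1/ l) l y ⟨
  ℚ.1/ l ℚ.* l ℚ.* y   ≡⟨ cong (ℚ._* y) (ℚ.*-inverseˡ l) ⟩
  1ℚ ℚ.* y             ≡⟨ ℚ.*-identityˡ y ⟩
  y                    ∎
  where
  open ≡-Reasoning
  instance _ = ℚ.≢-nonZero l≢0

private
  ℚ-dependent⇒minor : ∀ {l m} ui vi uj vj → l ≢ 0ℚ ⊎ m ≢ 0ℚ →
    l ℚ.* toℚ ui ℚ.+ m ℚ.* toℚ vi ≡ 0ℚ → l ℚ.* toℚ uj ℚ.+ m ℚ.* toℚ vj ≡ 0ℚ → ui * vj ≡ uj * vi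
  ℚ-dependent⇒minor ui vi uj vj nonzero hi hj = toℚ-injective (begin
    toℚ (ui * vj)     ≡⟨ toℚ-* ui vj ⟩
    toℚ ui ℚ.* toℚ vj ≡⟨ dependent⇒minor≈ ℚ.+-*-commutativeRing ℚ-*-almostCancelˡ nonzero hi hj ⟩
    toℚ uj ℚ.* toℚ vi ≡⟨ toℚ-* uj vi ⟨
    toℚ (uj * vi)     ∎)
    where open ≡-Reasoning

linIndepℚ⇔¬parallel : ∀ t1 t2 t3 s1 s2 s3 →
  LinIndepℚ t1 t2 t3 s1 s2 s3 ⇔ (¬ Parallel (t1 , t2 , t3) (s1 , s2 , s3))
linIndepℚ⇔¬parallel t1 t2 t3 s1 s2 s3 = mk⇔ independent⇒¬parallel ¬parallel⇒independent
  where
  independent⇒¬parallel : LinIndepℚ t1 t2 t3 s1 s2 s3 → ¬ Parallel (t1 , t2 , t3) (s1 , s2 , s3)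
  independent⇒¬parallel independent parallel
    with parallel⇒annihilated (t1 , t2 , t3) (s1 , s2 , s3) parallel
  ... | l , m , l≢0⊎m≢0 , eq
    with independent (toℚ l) (toℚ m) (toℚ-combination {l} {m} {t1} {s1} (cong proj₁ eq))
           (toℚ-combination {l} {m} {t2} {s2} (cong (proj₁ ∘ proj₂) eq))
           (toℚ-combination {l} {m} {t3} {s3} (cong (proj₂ ∘ proj₂) eq))
  ... | l≡0 , m≡0 = [ (λ l≢0 → l≢0 (toℚ-injective l≡0)) , (λ m≢0 → m≢0 (toℚ-injective m≡0)) ]′ l≢0⊎m≢0
  ¬parallel⇒independent : ¬ Parallel (t1 , t2 , t3) (s1 , s2 , s3) → LinIndepℚ t1 t2 t3 s1 s2 s3
  ¬parallel⇒independent ¬parallel l m h₁ h₂ h₃ =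
    decidable-stable (l ℚ.≟ 0ℚ) (λ l≢0 → ¬parallel (parallel (inj₁ l≢0))) ,
    decidable-stable (m ℚ.≟ 0ℚ) (λ m≢0 → ¬parallel (parallel (inj₂ m≢0)))
    where
    parallel : l ≢ 0ℚ ⊎ m ≢ 0ℚ → Parallel (t1 , t2 , t3) (s1 , s2 , s3)
    parallel nonzero = ℚ-dependent⇒minor t1 s1 t2 s2 nonzero h₁ h₂ ,
      ℚ-dependent⇒minor t1 s1 t3 s3 nonzero h₁ h₃ , ℚ-dependent⇒minor t2 s2 t3 s3 nonzero h₂ h₃

tr0-noncommuting⇔linIndepℚ : ∀ t1 t2 t3 s1 s2 s3 →
  (¬ tr0 t1 t2 t3 · tr0 s1 s2 s3 ≡ tr0 s1 s2 s3 · tr0 t1 t2 t3) ⇔ LinIndepℚ t1 t2 t3 s1 s2 s3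
tr0-noncommuting⇔linIndepℚ t1 t2 t3 s1 s2 s3 = mk⇔
  (λ noncommuting → from independence (noncommuting ∘ from commuting))
  (λ independent → to independence independent ∘ to commuting)
  where
  open Equivalence
  commuting : tr0 t1 t2 t3 · tr0 s1 s2 s3 ≡ tr0 s1 s2 s3 · tr0 t1 t2 t3 ⇔ Parallel (t1 , t2 , t3) (s1 , s2 , s3)
  commuting = commute-tr0⇔parallel t1 t2 t3 s1 s2 s3
  independence : LinIndepℚ t1 t2 t3 s1 s2 s3 ⇔ (¬ Parallel (t1 , t2 , t3) (s1 , s2 , s3))
  independence = linIndepℚ⇔¬parallel t1 t2 t3 s1 s2 s3

-- Scalar combinations and the traceless case

shape-⊕ : ∀ A B → shape (A ⊕ B) ≡ shape A +³ shape B
shape-⊕ (mat a b c d) (mat p q r s) = cong₂ _,_ refl (cong₂ _,_ refl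
  ((a + p) - (d + s) ≡ (a - d) + (p - s) ∋ solve (a ∷ d ∷ p ∷ s ∷ [])))

shape-⊙ : ∀ k A → shape (k ⊙ A) ≡ k ·³ shape A
shape-⊙ k (mat a b c d) = cong₂ _,_ refl (cong₂ _,_ refl (k * a - k * d ≡ k * (a - d) ∋ solve (k ∷ a ∷ d ∷ [])))

shape-scalar : ∀ k → shape (k ⊙ I) ≡ 0³
shape-scalar k = cong₂ _,_ (ℤ.*-zeroʳ k) (cong₂ _,_ (ℤ.*-zeroʳ k) (ℤ.+-inverseʳ (k * 1ℤ)))

-- The shadow of Cayley–Hamilton, M² = (tr M) M − (det M) I.
shape-sq : ∀ A → shape (sq A) ≡ tr A ·³ shape A
shape-sq (mat a b c d) =
  cong₂ _,_ (a * b + b * d ≡ (a + d) * b ∋ solve (a ∷ b ∷ d ∷ []))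
  (cong₂ _,_ (c * a + d * c ≡ (a + d) * c ∋ solve (a ∷ c ∷ d ∷ []))
             ((a * a + b * c) - (c * b + d * d) ≡ (a + d) * (a - d) ∋ solve (a ∷ b ∷ c ∷ d ∷ [])))

shape-weighted-sq : ∀ a X → shape (a ⊙ sq X) ≡ (a * tr X) ·³ shape X
shape-weighted-sq a X =
  trans (shape-⊙ a (sq X)) (trans (cong (a ·³_) (shape-sq X)) (·³-assoc a (tr X) (shape X)))

shape-fourth-power : ∀ X → shape (sq (sq X)) ≡ (tr (sq X) * tr X) ·³ shape X
shape-fourth-power X =
  trans (shape-sq (sq X)) (trans (cong (tr (sq X) ·³_) (shape-sq X)) (·³-assoc (tr (sq X)) (tr X) (shape X)))

-- shape A ≡ l ·³ shape X says that A is l X plus a scalar matrix.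
noncommuting⇒trivial-coefficients : ∀ {A B k l m} X Y → ¬ X · Y ≡ Y · X →
  shape A ≡ l ·³ shape X → shape B ≡ m ·³ shape Y → A ⊕ B ≡ k ⊙ I → l ≡ 0ℤ × m ≡ 0ℤ
noncommuting⇒trivial-coefficients {A} {B} {k} {l} {m} X Y X≁Y shape-A shape-B A⊕B≡kI =
  decidable-stable (l ℤ.≟ 0ℤ) (λ l≢0 → X≁Y (commute (inj₁ l≢0))) ,
  decidable-stable (m ℤ.≟ 0ℤ) (λ m≢0 → X≁Y (commute (inj₂ m≢0)))
  where
  annihilated : l ·³ shape X +³ m ·³ shape Y ≡ 0³
  annihilated = begin
    l ·³ shape X +³ m ·³ shape Y ≡⟨ cong₂ _+³_ shape-A shape-B ⟨
    shape A +³ shape B           ≡⟨ shape-⊕ A B ⟨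
    shape (A ⊕ B)                ≡⟨ cong shape A⊕B≡kI ⟩
    shape (k ⊙ I)                ≡⟨ shape-scalar k ⟩
    0³                           ∎
    where open ≡-Reasoning
  commute : l ≢ 0ℤ ⊎ m ≢ 0ℤ → X · Y ≡ Y · X
  commute nonzero = Equivalence.from (commute⇔parallel X Y) (annihilated⇒parallel _ _ nonzero annihilated)

scalar-injective : ∀ {k l} → k ⊙ I ≡ l ⊙ I → k ≡ l
scalar-injective {k} {l} kI≡lI = trans (sym (ℤ.*-identityʳ k)) (trans (cong e11 kI≡lI) (ℤ.*-identityʳ l))

scalar-≡⇔ : ∀ {A k l} → A ≡ k ⊙ I → (A ≡ l ⊙ I ⇔ k ≡ l)
scalar-≡⇔ A≡kI = mk⇔ (λ A≡lI → scalar-injective (trans (sym A≡kI) A≡lI)) (λ k≡l → trans A≡kI (cong (_⊙ I) k≡l))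

⊙-scalar : ∀ k l → k ⊙ (l ⊙ I) ≡ (k * l) ⊙ I
⊙-scalar k l =
  mat-cong (sym (ℤ.*-assoc k l 1ℤ)) (sym (ℤ.*-assoc k l 0ℤ)) (sym (ℤ.*-assoc k l 0ℤ)) (sym (ℤ.*-assoc k l 1ℤ))

scalar-⊕ : ∀ k l → (k ⊙ I) ⊕ (l ⊙ I) ≡ (k + l) ⊙ I
scalar-⊕ k l = mat-cong (sym (ℤ.*-distribʳ-+ 1ℤ k l)) (sym (ℤ.*-distribʳ-+ 0ℤ k l))
                        (sym (ℤ.*-distribʳ-+ 0ℤ k l)) (sym (ℤ.*-distribʳ-+ 1ℤ k l))

scalar-sum : ∀ {A B} k l {m} → A ≡ k ⊙ I → B ≡ l ⊙ I → A ⊕ B ≡ m ⊙ I → k + l ≡ m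
scalar-sum k l A≡kI B≡lI A⊕B≡mI =
  scalar-injective (trans (sym (scalar-⊕ k l)) (trans (cong₂ _⊕_ (sym A≡kI) (sym B≡lI)) A⊕B≡mI))

sq-scalar : ∀ k → sq (k ⊙ I) ≡ (k * k) ⊙ I
sq-scalar k = mat-cong (k * 1ℤ * (k * 1ℤ) + k * 0ℤ * (k * 0ℤ) ≡ k * k * 1ℤ ∋ solve (k ∷ []))
                       (k * 1ℤ * (k * 0ℤ) + k * 0ℤ * (k * 1ℤ) ≡ k * k * 0ℤ ∋ solve (k ∷ []))
                       (k * 0ℤ * (k * 1ℤ) + k * 1ℤ * (k * 0ℤ) ≡ k * k * 0ℤ ∋ solve (k ∷ []))
                       (k * 0ℤ * (k * 0ℤ) + k * 1ℤ * (k * 1ℤ) ≡ k * k * 1ℤ ∋ solve (k ∷ []))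

sq-tr0 : ∀ t1 t2 t3 → sq (tr0 t1 t2 t3) ≡ (t1 * t1 + t2 * t3) ⊙ I
sq-tr0 t1 t2 t3 = mat-cong
  (t1 * t1 + t2 * t3 ≡ (t1 * t1 + t2 * t3) * 1ℤ ∋ solve (t1 ∷ t2 ∷ t3 ∷ []))
  (t1 * t2 + t2 * - t1 ≡ (t1 * t1 + t2 * t3) * 0ℤ ∋ solve (t1 ∷ t2 ∷ t3 ∷ []))
  (t3 * t1 + - t1 * t3 ≡ (t1 * t1 + t2 * t3) * 0ℤ ∋ solve (t1 ∷ t2 ∷ t3 ∷ []))
  (t3 * t2 + - t1 * - t1 ≡ (t1 * t1 + t2 * t3) * 1ℤ ∋ solve (t1 ∷ t2 ∷ t3 ∷ []))

traceless⇒tr0 : ∀ {a b c d} → tr (mat a b c d) ≡ 0ℤ → mat a b c d ≡ tr0 a b c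
traceless⇒tr0 {a} {b} {c} {d} a+d≡0 = cong (mat a b c) (begin
  d              ≡⟨ solve (a ∷ d ∷ []) ⟩
  - a + (a + d)  ≡⟨ cong (_+_ (- a)) a+d≡0 ⟩
  - a + 0ℤ       ≡⟨ ℤ.+-identityʳ (- a) ⟩
  - a            ∎)
  where open ≡-Reasoning

traceless-sq : ∀ N → tr N ≡ 0ℤ → sq N ≡ (- det N) ⊙ I
traceless-sq (mat a b c d) trN≡0 with traceless⇒tr0 {a} {b} {c} {d} trN≡0
... | refl = trans (sq-tr0 a b c) (cong (_⊙ I) (a * a + b * c ≡ - (a * - a - b * c) ∋ solve (a ∷ b ∷ c ∷ [])))

det-sq : ∀ M → det (sq M) ≡ det M * det M
det-sq (mat a b c d) =
  (a * a + b * c) * (c * b + d * d) - (a * b + b * d) * (c * a + d * c) ≡ (a * d - b * c) * (a * d - b * c) ∋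
  solve (a ∷ b ∷ c ∷ d ∷ [])

tr-sq : ∀ M → tr (sq M) ≡ tr M * tr M - + 2 * det M
tr-sq (mat a b c d) =
  (a * a + b * c) + (c * b + d * d) ≡ (a + d) * (a + d) - + 2 * (a * d - b * c) ∋ solve (a ∷ b ∷ c ∷ d ∷ [])

TracelessSolution : (ℤ → ℤ → ℤ → ℤ → ℤ → ℤ → Set) → M₂ℤ → M₂ℤ → Set
TracelessSolution P X Y = ∃[ t1 ] ∃[ t2 ] ∃[ t3 ] ∃[ s1 ] ∃[ s2 ] ∃[ s3 ]
  ((X ≡ tr0 t1 t2 t3) × (Y ≡ tr0 s1 s2 s3) × P t1 t2 t3 s1 s2 s3 × LinIndepℚ t1 t2 t3 s1 s2 s3)

traceless-characterisation : (E : M₂ℤ → M₂ℤ → Set) (P : ℤ → ℤ → ℤ → ℤ → ℤ → ℤ → Set) →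
  (∀ X Y → E X Y → ¬ X · Y ≡ Y · X → tr X ≡ 0ℤ × tr Y ≡ 0ℤ) →
  (∀ t1 t2 t3 s1 s2 s3 → E (tr0 t1 t2 t3) (tr0 s1 s2 s3) ⇔ P t1 t2 t3 s1 s2 s3) →
  ∀ X Y → (E X Y × ¬ X · Y ≡ Y · X) ⇔ TracelessSolution P X Y
traceless-characterisation E P noncommuting⇒traceless equation X Y = mk⇔ (solve-traceless X Y) (check X Y)
  where
  open Equivalence
  solve-traceless : ∀ X Y → E X Y × ¬ X · Y ≡ Y · X → TracelessSolution P X Y
  solve-traceless (mat x1 x2 x3 x4) (mat y1 y2 y3 y4) (e , X≁Y)
    with noncommuting⇒traceless (mat x1 x2 x3 x4) (mat y1 y2 y3 y4) e X≁Y
  ... | trX≡0 , trY≡0 with traceless⇒tr0 {x1} {x2} {x3} {x4} trX≡0 | traceless⇒tr0 {y1} {y2} {y3} {y4} trY≡0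
  ... | refl | refl = x1 , x2 , x3 , y1 , y2 , y3 , refl , refl ,
    to (equation x1 x2 x3 y1 y2 y3) e , to (tr0-noncommuting⇔linIndepℚ x1 x2 x3 y1 y2 y3) X≁Y
  check : ∀ X Y → TracelessSolution P X Y → E X Y × ¬ X · Y ≡ Y · X
  check _ _ (t1 , t2 , t3 , s1 , s2 , s3 , refl , refl , p , independent) =
    from (equation t1 t2 t3 s1 s2 s3) p , from (tr0-noncommuting⇔linIndepℚ t1 t2 t3 s1 s2 s3) independent

weighted-squares : ∀ a b c → a ≢ 0ℤ → b ≢ 0ℤ → ∀ X Y →
  ((a ⊙ sq X) ⊕ (b ⊙ sq Y) ≡ c ⊙ I × ¬ X · Y ≡ Y · X) ⇔
  TracelessSolution (λ t1 t2 t3 s1 s2 s3 → a * (t1 * t1 + t2 * t3) + b * (s1 * s1 + s2 * s3) ≡ c) X Y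
weighted-squares a b c a≢0 b≢0 = traceless-characterisation _ _ traceless equation
  where
  traceless : ∀ X Y → (a ⊙ sq X) ⊕ (b ⊙ sq Y) ≡ c ⊙ I → ¬ X · Y ≡ Y · X → tr X ≡ 0ℤ × tr Y ≡ 0ℤ
  traceless X Y eq X≁Y = map (nonzero-factor a≢0) (nonzero-factor b≢0)
    (noncommuting⇒trivial-coefficients {a ⊙ sq X} {b ⊙ sq Y} {c} {a * tr X} {b * tr Y} X Y X≁Y
       (shape-weighted-sq a X) (shape-weighted-sq b Y) eq)
  equation : ∀ t1 t2 t3 s1 s2 s3 →
    ((a ⊙ sq (tr0 t1 t2 t3)) ⊕ (b ⊙ sq (tr0 s1 s2 s3)) ≡ c ⊙ I) ⇔
    (a * (t1 * t1 + t2 * t3) + b * (s1 * s1 + s2 * s3) ≡ c)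
  equation t1 t2 t3 s1 s2 s3 = scalar-≡⇔ (begin
    (a ⊙ sq (tr0 t1 t2 t3)) ⊕ (b ⊙ sq (tr0 s1 s2 s3))
      ≡⟨ cong₂ (λ A B → (a ⊙ A) ⊕ (b ⊙ B)) (sq-tr0 t1 t2 t3) (sq-tr0 s1 s2 s3) ⟩
    (a ⊙ (q ⊙ I)) ⊕ (b ⊙ (r ⊙ I))
      ≡⟨ cong₂ _⊕_ (⊙-scalar a q) (⊙-scalar b r) ⟩
    ((a * q) ⊙ I) ⊕ ((b * r) ⊙ I)
      ≡⟨ scalar-⊕ (a * q) (b * r) ⟩
    (a * q + b * r) ⊙ I ∎)
    where
    open ≡-Reasoning
    q : ℤ
    q = t1 * t1 + t2 * t3
    r : ℤ
    r = s1 * s1 + s2 * s3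

-- Fourth powers

square≡∣∣² : ∀ i → i * i ≡ + (∣ i ∣ ℕ.* ∣ i ∣)
square≡∣∣² (+ n) = sym (ℤ.pos-* n n)
square≡∣∣² -[1+ n ] = refl

fourth-power≡∣∣⁴ : ∀ i → i * i * (i * i) ≡ + (∣ i ∣ ℕ.* ∣ i ∣ ℕ.* (∣ i ∣ ℕ.* ∣ i ∣))
fourth-power≡∣∣⁴ i = trans (cong₂ _*_ (square≡∣∣² i) (square≡∣∣² i)) (sym (ℤ.pos-* (∣ i ∣ ℕ.* ∣ i ∣) (∣ i ∣ ℕ.* ∣ i ∣)))

i^4≡i²i² : ∀ i → i ^ 4 ≡ i * i * (i * i)
i^4≡i²i² i = i * (i * (i * (i * 1ℤ))) ≡ i * i * (i * i) ∋ solve (i ∷ [])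

neg-square : ∀ i → - i * - i ≡ i * i
neg-square = solve-∀

quartic-no-solutionℤ : ∀ {x y z} → x ≢ 0ℤ → y ≢ 0ℤ → x * x * (x * x) + + 4 * (y * y * (y * y)) ≢ z * z
quartic-no-solutionℤ {x} {y} {z} x≢0 y≢0 eq =
  no-quartic-solution ∣ z ∣ (∣ x ∣ , ∣ y ∣ , x≢0 ∘ ℤ.∣i∣≡0⇒i≡0 , y≢0 ∘ ℤ.∣i∣≡0⇒i≡0 , ℤ.+-injective (begin
    + (X⁴ ℕ.+ 4 ℕ.* Y⁴)                         ≡⟨ ℤ.pos-+ X⁴ (4 ℕ.* Y⁴) ⟩
    + X⁴ + + (4 ℕ.* Y⁴)                         ≡⟨ cong (_+_ (+ X⁴)) (ℤ.pos-* 4 Y⁴) ⟩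
    + X⁴ + + 4 * + Y⁴                           ≡⟨ cong₂ (λ u v → u + + 4 * v) (fourth-power≡∣∣⁴ x) (fourth-power≡∣∣⁴ y) ⟨
    x * x * (x * x) + + 4 * (y * y * (y * y))   ≡⟨ eq ⟩
    z * z                                       ≡⟨ square≡∣∣² z ⟩
    + (∣ z ∣ ℕ.* ∣ z ∣)                         ∎))
  where
  open ≡-Reasoning
  X⁴ : ℕ.ℕ
  X⁴ = ∣ x ∣ ℕ.* ∣ x ∣ ℕ.* (∣ x ∣ ℕ.* ∣ x ∣)
  Y⁴ : ℕ.ℕ
  Y⁴ = ∣ y ∣ ℕ.* ∣ y ∣ ℕ.* (∣ y ∣ ℕ.* ∣ y ∣)

mixed-fourth-powers-impossible : ∀ {t d e c} → t ≢ 0ℤ → c ≢ 0ℤ → t * t ≡ + 2 * d →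
  - (d * d) + e * e ≡ c ^ 4 → ⊥
mixed-fourth-powers-impossible {t} {d} {e} {c} t≢0 c≢0 t²≡2d eq =
  quartic-no-solutionℤ {z = + 2 * e} t≢0 c≢0 (begin
    t * t * (t * t) + + 4 * (c * c * (c * c))       ≡⟨ cong₂ (λ u v → u * u + + 4 * v) t²≡2d (sym (i^4≡i²i² c)) ⟩
    + 2 * d * (+ 2 * d) + + 4 * c ^ 4               ≡⟨ cong (λ v → + 2 * d * (+ 2 * d) + + 4 * v) eq ⟨
    + 2 * d * (+ 2 * d) + + 4 * (- (d * d) + e * e) ≡⟨ solve (d ∷ e ∷ []) ⟩
    + 2 * e * (+ 2 * e)                             ∎)
  where open ≡-Reasoning

negative-fourth-powers-impossible : ∀ {d e c} → c ≢ 0ℤ → - (d * d) + - (e * e) ≡ c ^ 4 → ⊥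
negative-fourth-powers-impossible {d} {e} {c} c≢0 eq = c≢0 (ℤ.i^n≡0⇒i≡0 c 4 (begin
  c ^ 4           ≡⟨ i^4≡i²i² c ⟩
  c * c * (c * c) ≡⟨ fourth-power≡∣∣⁴ c ⟩
  + C⁴            ≡⟨ cong +_ (ℕ.m+n≡0⇒m≡0 C⁴ (ℤ.+-injective sum≡0)) ⟩
  0ℤ              ∎))
  where
  open ≡-Reasoning
  C⁴ : ℕ.ℕ
  C⁴ = ∣ c ∣ ℕ.* ∣ c ∣ ℕ.* (∣ c ∣ ℕ.* ∣ c ∣)
  D² : ℕ.ℕ
  D² = ∣ d ∣ ℕ.* ∣ d ∣
  E² : ℕ.ℕ
  E² = ∣ e ∣ ℕ.* ∣ e ∣
  sum≡0 : + (C⁴ ℕ.+ (D² ℕ.+ E²)) ≡ 0ℤ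
  sum≡0 = begin
    + (C⁴ ℕ.+ (D² ℕ.+ E²))                  ≡⟨ trans (ℤ.pos-+ C⁴ (D² ℕ.+ E²)) (cong (_+_ (+ C⁴)) (ℤ.pos-+ D² E²)) ⟩
    + C⁴ + (+ D² + + E²)                    ≡⟨ cong₂ _+_ (fourth-power≡∣∣⁴ c) (cong₂ _+_ (square≡∣∣² d) (square≡∣∣² e)) ⟨
    c * c * (c * c) + (d * d + e * e)       ≡⟨ cong (λ v → v + (d * d + e * e)) (i^4≡i²i² c) ⟨
    c ^ 4 + (d * d + e * e)                 ≡⟨ cong (λ v → v + (d * d + e * e)) eq ⟨
    - (d * d) + - (e * e) + (d * d + e * e) ≡⟨ solve (d ∷ e ∷ []) ⟩
    0ℤ                                      ∎

fourth-power-dichotomy : ∀ M → tr (sq M) * tr M ≡ 0ℤ →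
  (tr M ≡ 0ℤ × sq (sq M) ≡ (det M * det M) ⊙ I) ⊎
  (tr M ≢ 0ℤ × tr M * tr M ≡ + 2 * det M × sq (sq M) ≡ (- (det M * det M)) ⊙ I)
fourth-power-dichotomy M trM²·trM≡0 with tr M ℤ.≟ 0ℤ
... | yes trM≡0 = inj₁ (trM≡0 , (begin
  sq (sq M)               ≡⟨ cong sq (traceless-sq M trM≡0) ⟩
  sq ((- det M) ⊙ I)      ≡⟨ sq-scalar (- det M) ⟩
  (- det M * - det M) ⊙ I ≡⟨ cong (_⊙ I) (neg-square (det M)) ⟩
  (det M * det M) ⊙ I     ∎))
  where open ≡-Reasoning
... | no trM≢0 = inj₂ (trM≢0 , ℤ.i-j≡0⇒i≡j _ _ (trans (sym (tr-sq M)) trM²≡0) , (begin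
  sq (sq M)               ≡⟨ traceless-sq (sq M) trM²≡0 ⟩
  (- det (sq M)) ⊙ I      ≡⟨ cong (λ k → (- k) ⊙ I) (det-sq M) ⟩
  (- (det M * det M)) ⊙ I ∎))
  where
  open ≡-Reasoning
  trM²≡0 : tr (sq M) ≡ 0ℤ
  trM²≡0 = nonzero-factor trM≢0 (trans (ℤ.*-comm (tr M) (tr (sq M))) trM²·trM≡0)

fourth-powers-traceless : ∀ {c} X Y → c ≢ 0ℤ → sq (sq X) ⊕ sq (sq Y) ≡ (c ^ 4) ⊙ I →
  tr (sq X) * tr X ≡ 0ℤ → tr (sq Y) * tr Y ≡ 0ℤ → tr X ≡ 0ℤ × tr Y ≡ 0ℤ
fourth-powers-traceless X Y c≢0 eq trX²·trX≡0 trY²·trY≡0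
  with fourth-power-dichotomy X trX²·trX≡0 | fourth-power-dichotomy Y trY²·trY≡0
... | inj₁ (trX≡0 , _) | inj₁ (trY≡0 , _) = trX≡0 , trY≡0
... | inj₂ (trX≢0 , trX²≡2detX , X⁴≡) | inj₁ (_ , Y⁴≡) =
  ⊥-elim (mixed-fourth-powers-impossible {d = det X} {e = det Y} trX≢0 c≢0 trX²≡2detX
    (scalar-sum (- (det X * det X)) (det Y * det Y) X⁴≡ Y⁴≡ eq))
... | inj₁ (_ , X⁴≡) | inj₂ (trY≢0 , trY²≡2detY , Y⁴≡) =
  ⊥-elim (mixed-fourth-powers-impossible {d = det Y} {e = det X} trY≢0 c≢0 trY²≡2detY
    (trans (ℤ.+-comm (- (det Y * det Y)) (det X * det X)) (scalar-sum (det X * det X) (- (det Y * det Y)) X⁴≡ Y⁴≡ eq)))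
... | inj₂ (_ , _ , X⁴≡) | inj₂ (_ , _ , Y⁴≡) =
  ⊥-elim (negative-fourth-powers-impossible {d = det X} {e = det Y} c≢0
    (scalar-sum (- (det X * det X)) (- (det Y * det Y)) X⁴≡ Y⁴≡ eq))

fourth-powers : ∀ c → c ≢ 0ℤ → ∀ X Y →
  ((sq (sq X) ⊕ sq (sq Y) ≡ (c ^ 4) ⊙ I) × ¬ X · Y ≡ Y · X) ⇔
  TracelessSolution (λ t1 t2 t3 s1 s2 s3 → (t1 * t1 + t2 * t3) ^ 2 + (s1 * s1 + s2 * s3) ^ 2 ≡ c ^ 4) X Y
fourth-powers c c≢0 = traceless-characterisation _ _ traceless equation
  where
  traceless : ∀ X Y → sq (sq X) ⊕ sq (sq Y) ≡ (c ^ 4) ⊙ I → ¬ X · Y ≡ Y · X → tr X ≡ 0ℤ × tr Y ≡ 0ℤ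
  traceless X Y eq X≁Y = uncurry (fourth-powers-traceless X Y c≢0 eq)
    (noncommuting⇒trivial-coefficients {sq (sq X)} {sq (sq Y)} {c ^ 4} {tr (sq X) * tr X} {tr (sq Y) * tr Y}
       X Y X≁Y (shape-fourth-power X) (shape-fourth-power Y) eq)
  fourth-power-tr0 : ∀ t1 t2 t3 → let q = t1 * t1 + t2 * t3 in sq (sq (tr0 t1 t2 t3)) ≡ (q * q) ⊙ I
  fourth-power-tr0 t1 t2 t3 = trans (cong sq (sq-tr0 t1 t2 t3)) (sq-scalar (t1 * t1 + t2 * t3))
  square : ∀ q → q ^ 2 ≡ q * q
  square q = cong (q *_) (ℤ.*-identityʳ q)
  equation : ∀ t1 t2 t3 s1 s2 s3 →
    (sq (sq (tr0 t1 t2 t3)) ⊕ sq (sq (tr0 s1 s2 s3)) ≡ (c ^ 4) ⊙ I) ⇔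
    ((t1 * t1 + t2 * t3) ^ 2 + (s1 * s1 + s2 * s3) ^ 2 ≡ c ^ 4)
  equation t1 t2 t3 s1 s2 s3 = scalar-≡⇔ (begin
    sq (sq (tr0 t1 t2 t3)) ⊕ sq (sq (tr0 s1 s2 s3))
      ≡⟨ cong₂ _⊕_ (fourth-power-tr0 t1 t2 t3) (fourth-power-tr0 s1 s2 s3) ⟩
    ((q * q) ⊙ I) ⊕ ((r * r) ⊙ I) ≡⟨ scalar-⊕ (q * q) (r * r) ⟩
    (q * q + r * r) ⊙ I           ≡⟨ cong (_⊙ I) (cong₂ _+_ (square q) (square r)) ⟨
    (q ^ 2 + r ^ 2) ⊙ I           ∎)
    where
    open ≡-Reasoning
    q : ℤ
    q = t1 * t1 + t2 * t3
    r : ℤ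
    r = s1 * s1 + s2 * s3

proposition2p3 : (a b c : ℤ) → ¬ (a ≡ + 0) → ¬ (b ≡ + 0) → ¬ (c ≡ + 0) → gcd₃ a b c ≡ + 1 →
    (X Y : M₂ℤ) →
    ((((a ⊙ sq X) ⊕ (b ⊙ sq Y) ≡ c ⊙ I) × ¬ (X · Y ≡ Y · X))
      ⇔ (∃[ t1 ] ∃[ t2 ] ∃[ t3 ] ∃[ s1 ] ∃[ s2 ] ∃[ s3 ]
           ((X ≡ tr0 t1 t2 t3) × (Y ≡ tr0 s1 s2 s3)
            × (a * (t1 * t1 + t2 * t3) + b * (s1 * s1 + s2 * s3) ≡ c)
            × LinIndepℚ t1 t2 t3 s1 s2 s3)))
    × ((((sq (sq X)) ⊕ (sq (sq Y)) ≡ (c ^ 4) ⊙ I) × ¬ (X · Y ≡ Y · X))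
      ⇔ (∃[ t1 ] ∃[ t2 ] ∃[ t3 ] ∃[ s1 ] ∃[ s2 ] ∃[ s3 ]
           ((X ≡ tr0 t1 t2 t3) × (Y ≡ tr0 s1 s2 s3)
            × ((t1 * t1 + t2 * t3) ^ 2 + (s1 * s1 + s2 * s3) ^ 2 ≡ c ^ 4)
            × LinIndepℚ t1 t2 t3 s1 s2 s3)))
proposition2p3 a b c a≢0 b≢0 c≢0 _ X Y = weighted-squares a b c a≢0 b≢0 X Y , fourth-powers c c≢0 X Y
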